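{- Let $d$ be the degree sequence of a forest without isolated vertices. Then for every forest $F$ with degree sequence $d$ and every 2-switch $\tau$ on $F$ such that $\tau(F)$ is a forest, $|\gamma_{gr}^{Z}(\tau(F))-\gamma_{gr}^{Z}(F)|\le 1$, where $\gamma_{gr}^{Z}$ is the Z-Grundy domination number.
   Context: Graphs are finite and simple. A 2-switch on $G$ is specified by four distinct vertices $a,b,c,d$ with $ab,cd\in E(G)$ and $ac,bd\notin E(G)$; it produces $\tau(G)=G-ab-cd+ac+bd$. For a graph $G$ without isolated vertices, a sequence $(v_1,\dots,v_k)$ of vertices is a Z-sequence if for each $i$, $N_i-\bigcup_{j=1}^{i-1}(N_j\cup\{v_j\})\neq\varnothing$, where $N_i$ is the open neighborhood of $v_i$; $\gamma_{gr}^{Z}(G)$ is the maximum length of a Z-sequence. -}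

module Defs where

open import Data.Nat using (ℕ; _≤_)
open import Data.Fin using (Fin; _≟_)
open import Data.Bool using (Bool; true; false; if_then_else_; _∧_; _∨_; T)
open import Data.List using (List; []; _∷_; length)
open import Data.List.Relation.Unary.All using (All)
open import Data.List.Relation.Unary.AllPairs using (AllPairs)
open import Data.Product using (Σ; ∃; _×_)
open import Relation.Nullary using (¬_; does)
open import Relation.Binary.PropositionalEquality using (_≡_; _≢_)

Adj : ℕ → Set
Adj n = Fin n → Fin n → Bool

_∼[_]_ : ∀ {n} → Fin n → Adj n → Fin n → Set
x ∼[ G ] y = T (G x y)

IsSimple : ∀ {n} → Adj n → Set
IsSimple {n} G = (∀ (x y : Fin n) → G x y ≡ G y x) × (∀ (x : Fin n) → G x x ≡ false)

NoIsolated : ∀ {n} → Adj n → Set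
NoIsolated {n} G = ∀ (x : Fin n) → ∃ λ y → x ∼[ G ] y

Walk : ∀ {n} → Adj n → List (Fin n) → Set
Walk G [] = Data.Unit.⊤ where import Data.Unit
Walk G (x ∷ []) = Data.Unit.⊤ where import Data.Unit
Walk G (x ∷ y ∷ xs) = x ∼[ G ] y × Walk G (y ∷ xs)

last : ∀ {n} → Fin n → List (Fin n) → Fin n
last x [] = x
last x (y ∷ ys) = last y ys

IsCycle : ∀ {n} → Adj n → List (Fin n) → Set
IsCycle G [] = Data.Empty.⊥ where import Data.Empty
IsCycle G (v ∷ vs) =
  (3 ≤ length (v ∷ vs)) × AllPairs _≢_ (v ∷ vs) × Walk G (v ∷ vs) × (last v vs ∼[ G ] v)

IsForest : ∀ {n} → Adj n → Set
IsForest {n} G = ∀ (c : List (Fin n)) → ¬ IsCycle G c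

IsTwoSwitch : ∀ {n} → Adj n → Fin n → Fin n → Fin n → Fin n → Set
IsTwoSwitch G a b c d =
  AllPairs _≢_ (a ∷ b ∷ c ∷ d ∷ []) ×
  a ∼[ G ] b × c ∼[ G ] d × ¬ (a ∼[ G ] c) × ¬ (b ∼[ G ] d)

samePair : ∀ {n} → Fin n → Fin n → Fin n → Fin n → Bool
samePair x y u v = (does (x ≟ u) ∧ does (y ≟ v)) ∨ (does (x ≟ v) ∧ does (y ≟ u))

twoSwitch : ∀ {n} → Adj n → Fin n → Fin n → Fin n → Fin n → Adj n
twoSwitch G a b c d x y =
  if samePair x y a b ∨ samePair x y c d then false
  else if samePair x y a c ∨ samePair x y b d then true
  else G x y

-- Z-sequence condition, with `prev` the list of earlier vertices:
-- each v_i has a neighbour w not in ⋃_{j<i} (N(v_j) ∪ {v_j}).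
ZSeqFrom : ∀ {n} → Adj n → List (Fin n) → List (Fin n) → Set
ZSeqFrom G prev [] = Data.Unit.⊤ where import Data.Unit
ZSeqFrom G prev (v ∷ vs) =
  (∃ λ w → v ∼[ G ] w × All (λ u → ¬ (u ∼[ G ] w) × u ≢ w) prev) ×
  ZSeqFrom G (v ∷ prev) vs

IsZSeq : ∀ {n} → Adj n → List (Fin n) → Set
IsZSeq G s = ZSeqFrom G [] s

IsZGrundyNumber : ∀ {n} → Adj n → ℕ → Set
IsZGrundyNumber {n} G k =
  (∃ λ (s : List (Fin n)) → IsZSeq G s × length s ≡ k) ×
  (∀ (s : List (Fin n)) → IsZSeq G s → length s ≤ k)

{-# OPTIONS --safe #-}
module Submission where

-- Recording each vertex vᵢ of a Z-sequence together with a neighbour wᵢ outside the closed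
-- neighbourhoods of v₁, …, vᵢ₋₁ gives arcs vᵢ → wᵢ along edges with distinct tails, distinct
-- heads and no arc reversing another: an arc system.  In a forest every arc system is ordered
-- back into a Z-sequence: if no arc could be played first, chasing arcs that must precede one
-- another would trace ever longer paths.  So γ_gr^Z of a forest is the largest size of an arc
-- system.  A 2-switch destroys at most the arcs lying on ab and cd.  When both are destroyed one
-- arc on ac or bd is regained: directly if the lost arcs were a → b and d → c (or b → a and
-- c → d), and otherwise, say for a → b and c → d, after reversing the directed path of arcs that
-- ends in c, which frees c to be the head of a → c.

open import Defs
open import Data.Nat using (ℕ; _≤_; ∣_-_∣)
open import Data.Fin using (Fin)
open import Data.Nat using (zero; suc; _+_; _<_; z≤n; s≤s)
open import Data.Nat.Properties
  using (_≤?_; ≤-refl; ≤-trans; ≤-reflexive; n≤1+n; m≤m+n; +-suc; +-monoʳ-≤; <⇒≱; ≰⇒>; suc-injective;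
         module ≤-Reasoning)
open import Data.Fin using (zero; suc; _≟_) renaming (_<_ to _<ᶠ_)
open import Data.Fin.Properties using (pigeonhole)
open import Data.Bool using (T; true; false; _∧_; _∨_; if_then_else_)
open import Data.Bool.Properties using (∧-comm; ∨-comm)
open import Data.List using (List; []; _∷_; length; map; lookup)
open import Data.List.Properties using (length-map)
open import Data.List.Relation.Unary.All as All using (All; []; _∷_)
open import Data.List.Relation.Unary.All.Properties using (anti-mono; map⁺)
open import Data.List.Relation.Unary.All.Properties.Core using (¬Any⇒All¬)
open import Data.List.Relation.Unary.Any using (here; there; any?)
open import Data.List.Relation.Unary.AllPairs using (AllPairs; []; _∷_)
open import Data.List.Relation.Unary.Unique.Propositional using (Unique)
open import Data.List.Membership.Propositional using (_∈_; _∉_; find)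
open import Data.List.Membership.Propositional.Properties using (∈-lookup)
import Data.List.Membership.DecPropositional as DecMembership
open import Data.List.Relation.Binary.Subset.Propositional using (_⊆_)
open import Data.List.Relation.Binary.Subset.Propositional.Properties using (∷⁺ʳ; ⊆-trans)
open import Data.Product using (Σ; ∃; _×_; _,_; proj₁; proj₂; swap)
open import Data.Product.Properties using (≡-dec)
open import Data.Sum using (_⊎_; inj₁; inj₂; [_,_])
open import Data.Unit using (tt)
open import Function using (_∘_; id)
open import Function.Bundles using (_⇔_; mk⇔; Equivalence)
open import Relation.Nullary using (¬_; Dec; yes; no; does; contradiction)
open import Relation.Nullary.Decidable
  using (_×-dec_; _⊎-dec_; ¬?; T?; dec-true; dec-false; decidable-stable)
open import Relation.Binary.Definitions using (Symmetric; DecidableEquality)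
open import Relation.Binary.PropositionalEquality
  using (_≡_; _≢_; refl; sym; trans; cong; cong₂; subst; subst₂)

open Equivalence using (to; from)

∣m-n∣≤1 : ∀ {m n} → n ≤ suc m → m ≤ suc n → ∣ m - n ∣ ≤ 1
∣m-n∣≤1 {zero}          n≤1       _         = n≤1
∣m-n∣≤1 {suc m} {zero}  _         m≤0       = m≤0
∣m-n∣≤1 {suc m} {suc n} (s≤s n≤m) (s≤s m≤n) = ∣m-n∣≤1 n≤m m≤n

module _ {S Goal : Set} (size : S → ℕ) {bound : ℕ} (bounded : ∀ s → size s ≤ bound)
         (step : ∀ s → Goal ⊎ ∃ λ s′ → size s < size s′) where

  bounded-ascent : S → Goal
  bounded-ascent s = climb (suc bound) s (s≤s (m≤m+n bound (size s)))
    where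
    climb : ∀ fuel s → bound < fuel + size s → Goal
    climb fuel s room with step s
    ... | inj₁ goal = goal
    climb zero s room | inj₂ _ = contradiction (bounded s) (<⇒≱ room)
    climb (suc fuel) s room | inj₂ (s′ , grows) = climb fuel s′ (begin-strict
      bound               <⟨ room ⟩
      suc fuel + size s   ≡⟨ sym (+-suc fuel (size s)) ⟩
      fuel + suc (size s) ≤⟨ +-monoʳ-≤ fuel grows ⟩
      fuel + size s′      ∎)
      where open ≤-Reasoning

module _ {A : Set} {R : A → A → Set} where

  AllPairs-lookup : ∀ {xs} → AllPairs R xs → ∀ {i j} → i <ᶠ j → R (lookup xs i) (lookup xs j)
  AllPairs-lookup (Rx ∷ _)  {zero}  {suc j} _         = All.lookup Rx (∈-lookup j)
  AllPairs-lookup (_ ∷ Rxs) {suc i} {suc j} (s≤s i<j) = AllPairs-lookup Rxs i<j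

  module _ (R-sym : Symmetric R) where

    AllPairs-∈ : ∀ {xs x y} → AllPairs R xs → x ∈ xs → y ∈ xs → x ≢ y → R x y
    AllPairs-∈ _         (here refl) (here refl) x≢y = contradiction refl x≢y
    AllPairs-∈ (Rx ∷ _)  (here refl) (there y∈)  _   = All.lookup Rx y∈
    AllPairs-∈ (Rx ∷ _)  (there x∈)  (here refl) _   = R-sym (All.lookup Rx x∈)
    AllPairs-∈ (_ ∷ Rxs) (there x∈)  (there y∈)  x≢y = AllPairs-∈ Rxs x∈ y∈ x≢y

    AllPairs-remove : ∀ {xs x} → AllPairs R xs → x ∈ xs →
      ∃ λ ys → length xs ≡ suc (length ys) × AllPairs R ys × All (R x) ys × ys ⊆ xs
    AllPairs-remove (Rx ∷ Rxs) (here refl) = _ , refl , Rxs , Rx , there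
    AllPairs-remove {y ∷ _} (Ry ∷ Rxs) (there x∈)
      with ys , len , Rys , Rxys , ys⊆ ← AllPairs-remove Rxs x∈ =
      y ∷ ys , cong suc len , anti-mono ys⊆ Ry ∷ Rys , R-sym (All.lookup Ry x∈) ∷ Rxys ,
      λ { (here refl) → here refl ; (there z∈) → there (ys⊆ z∈) }

AllPairs-map-with : ∀ {A B : Set} {P : A → Set} {R : A → A → Set} {S : B → B → Set} {f : A → B} {xs} →
  (∀ {x y} → P x → P y → R x y → S (f x) (f y)) → All P xs → AllPairs R xs → AllPairs S (map f xs)
AllPairs-map-with g []         []         = []
AllPairs-map-with g (px ∷ pxs) (Rx ∷ Rxs) =
  map⁺ (All.zipWith (λ (py , r) → g px py r) (pxs , Rx)) ∷ AllPairs-map-with g pxs Rxs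

module _ {n : ℕ} where

  private variable
    G G′ : Adj n
    a b c d p q t h x y : Fin n
    P xs : List (Fin n)

  Unique⇒length≤ : Unique xs → length xs ≤ n
  Unique⇒length≤ {xs = xs} unique with length xs ≤? n
  ... | yes fits = fits
  ... | no overflows with i , j , i<j , same ← pigeonhole (≰⇒> overflows) (lookup xs) =
    contradiction same (AllPairs-lookup unique i<j)

  ∼-sym : IsSimple G → x ∼[ G ] y → y ∼[ G ] x
  ∼-sym {G = G} {x = x} {y = y} (symmetric , _) = subst T (symmetric x y)

  ∼-irrefl : IsSimple G → x ∼[ G ] y → x ≢ y
  ∼-irrefl {G = G} {x = x} (_ , loopless) x∼x refl = subst T (loopless x) x∼x

  IsPath : Adj n → List (Fin n) → Set
  IsPath G P = Unique P × Walk G P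

  prefix : x ∈ xs → List (Fin n)
  prefix {xs = y ∷ _} (here _)   = y ∷ []
  prefix {xs = y ∷ _} (there x∈) = y ∷ prefix x∈

  prefix-last : ∀ z (x∈ : x ∈ xs) → last z (prefix x∈) ≡ x
  prefix-last z (here refl) = refl
  prefix-last {xs = y ∷ _} z (there x∈) = prefix-last y x∈

  prefix-nonempty : (x∈ : x ∈ xs) → 1 ≤ length (prefix x∈)
  prefix-nonempty (here _)  = s≤s z≤n
  prefix-nonempty (there _) = s≤s z≤n

  prefix-⊆ : (x∈ : x ∈ xs) → prefix x∈ ⊆ xs
  prefix-⊆ (here _)   (here refl) = here refl
  prefix-⊆ (there _)  (here refl) = here refl
  prefix-⊆ (there x∈) (there y∈)  = there (prefix-⊆ x∈ y∈)

  prefix-unique : (x∈ : x ∈ xs) → Unique xs → Unique (prefix x∈)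
  prefix-unique (here _)   (_ ∷ _)         = [] ∷ []
  prefix-unique (there x∈) (y≢ ∷ unique) = anti-mono (prefix-⊆ x∈) y≢ ∷ prefix-unique x∈ unique

  prefix-walk : ∀ z (x∈ : x ∈ xs) → Walk G (z ∷ xs) → Walk G (z ∷ prefix x∈)
  prefix-walk z (here _)   (z∼ , _)    = z∼ , tt
  prefix-walk {xs = y ∷ _} z (there x∈) (z∼ , walk) = z∼ , prefix-walk y x∈ walk

  forest-no-chord : IsForest G → IsPath G (h ∷ t ∷ P) → x ∼[ G ] h → x ∉ P
  forest-no-chord {G = G} {h = h} {t = t} forest ((h≢ ∷ t≢ ∷ unique) , h∼t , walk) x∼h x∈ =
    forest (h ∷ t ∷ prefix x∈) (length≥3 , unique′ , (h∼t , prefix-walk t x∈ walk) , closes)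
    where
    length≥3 : 3 ≤ length (h ∷ t ∷ prefix x∈)
    length≥3 = s≤s (s≤s (prefix-nonempty x∈))
    unique′ : Unique (h ∷ t ∷ prefix x∈)
    unique′ = anti-mono (∷⁺ʳ t (prefix-⊆ x∈)) h≢ ∷ anti-mono (prefix-⊆ x∈) t≢
            ∷ prefix-unique x∈ unique
    closes : last t (prefix x∈) ∼[ G ] h
    closes = subst (_∼[ G ] h) (sym (prefix-last t x∈)) x∼h

  path-extend : IsSimple G → IsForest G → IsPath G (h ∷ t ∷ P) → x ∼[ G ] h → x ≢ t →
    IsPath G (x ∷ h ∷ t ∷ P)
  path-extend {G = G} {h = h} {t = t} {P = P} {x = x} simple forest path@(unique , walk) x∼h x≢t =
    (¬Any⇒All¬ _ x∉ ∷ unique) , x∼h , walk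
    where
    x∉ : x ∉ h ∷ t ∷ P
    x∉ (here x≡h)          = ∼-irrefl simple x∼h x≡h
    x∉ (there (here x≡t))  = x≢t x≡t
    x∉ (there (there x∈P)) = forest-no-chord forest path x∼h x∈P

  Arc : Set
  Arc = Fin n × Fin n

  tail head : Arc → Fin n
  tail = proj₁
  head = proj₂

  _≟ₐ_ : DecidableEquality Arc
  _≟ₐ_ = ≡-dec _≟_ _≟_

  Compatible : Arc → Arc → Set
  Compatible e f = tail e ≢ tail f × head e ≢ head f × e ≢ swap f

  private variable
    e f : Arc
    D : List Arc
    L : List (Fin n)

  compatible-sym : Symmetric Compatible
  compatible-sym (tails≢ , heads≢ , ≢swap) =
    tails≢ ∘ sym , heads≢ ∘ sym , λ e≡swap-f → ≢swap (sym (cong swap e≡swap-f))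

  compatible⇒≢ : Compatible e f → e ≢ f
  compatible⇒≢ (tails≢ , _) refl = tails≢ refl

  record ArcSystem (G : Adj n) (D : List Arc) : Set where
    constructor arcSystem
    field
      compatible : AllPairs Compatible D
      alongEdges : All (λ e → tail e ∼[ G ] head e) D

  open ArcSystem

  module _ (compatible : AllPairs Compatible D) (e∈ : e ∈ D) (f∈ : f ∈ D) where

    same-tail⇒≡ : tail e ≡ tail f → e ≡ f
    same-tail⇒≡ same = decidable-stable (_ ≟ₐ _) λ e≢f →
      proj₁ (AllPairs-∈ compatible-sym compatible e∈ f∈ e≢f) same

    same-head⇒≡ : head e ≡ head f → e ≡ f
    same-head⇒≡ same = decidable-stable (_ ≟ₐ _) λ e≢f →
      proj₁ (proj₂ (AllPairs-∈ compatible-sym compatible e∈ f∈ e≢f)) same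

  Undominated : Adj n → List (Fin n) → Fin n → Set
  Undominated G us w = All (λ u → ¬ (u ∼[ G ] w) × u ≢ w) us

  zSeq⇒arcSystem : ∀ {prev} s → ZSeqFrom G prev s →
    ∃ λ D → ArcSystem G D × All (Undominated G prev ∘ head) D × length D ≡ length s
  zSeq⇒arcSystem [] _ = [] , arcSystem [] [] , [] , refl
  zSeq⇒arcSystem {G = G} {prev = prev} (v ∷ s) ((w , v∼w , w-undominated) , rest)
    with D , arcSystem compatible edges , undominated , len ← zSeq⇒arcSystem s rest =
    (v , w) ∷ D ,
    arcSystem (All.zipWith witness-compatible (undominated , edges) ∷ compatible) (v∼w ∷ edges) ,
    w-undominated ∷ All.map All.tail undominated ,
    cong suc len
    where
    witness-compatible : Undominated G (v ∷ prev) (head e) × tail e ∼[ G ] head e → Compatible (v , w) e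
    witness-compatible {e} ((v≁ , v≢) ∷ _ , e-edge) =
      (λ v≡ → v≁ (subst (_∼[ G ] head e) (sym v≡) e-edge)) ,
      (λ w≡ → v≁ (subst (v ∼[ G ]_) w≡ v∼w)) ,
      (λ vw≡ → v≢ (cong proj₁ vw≡))

  Dominates : Adj n → Fin n → Fin n → Set
  Dominates G u w = u ∼[ G ] w ⊎ u ≡ w

  -- Playing f before e would dominate the witness of e.
  MustPrecede : Adj n → Arc → Arc → Set
  MustPrecede G e f = e ≢ f × Dominates G (tail f) (head e)

  mustPrecede? : ∀ G e f → Dec (MustPrecede G e f)
  mustPrecede? G e f = ¬? (e ≟ₐ f) ×-dec (T? (G (tail f) (head e)) ⊎-dec (tail f ≟ head e))

  module _ (simple : IsSimple G) (forest : IsForest G) where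

    path-back : Compatible e f → tail e ∼[ G ] head e → Dominates G (tail f) (head e) →
      IsPath G (tail f ∷ head f ∷ P) →
      ∃ λ P′ → IsPath G (tail e ∷ head e ∷ P′) × length P < length P′
    path-back (tails≢ , heads≢ , _) e-edge (inj₁ tf∼he) path =
      _ , path-extend simple forest (path-extend simple forest path (∼-sym simple tf∼he) heads≢)
                      e-edge tails≢ ,
      n≤1+n _
    path-back (_ , _ , ≢swap) e-edge (inj₂ refl) path =
      _ , path-extend simple forest path e-edge (≢swap ∘ cong (_, _)) , ≤-refl

    minimal-arc : ArcSystem G D → f ∈ D → ∃ λ f → f ∈ D × All (λ e → ¬ MustPrecede G e f) D
    minimal-arc {D = D} {f = f₀} system f₀∈ =
      bounded-ascent size (Unique⇒length≤ ∘ proj₁ ∘ path) step (f₀ , f₀∈ , [] , start)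
      where
      Chase : Set
      Chase = Σ Arc λ f → f ∈ D × Σ (List (Fin n)) λ P → IsPath G (tail f ∷ head f ∷ P)

      path : ((f , _ , P , _) : Chase) → IsPath G (tail f ∷ head f ∷ P)
      path (_ , _ , _ , isPath) = isPath

      size : Chase → ℕ
      size (_ , _ , P , _) = suc (suc (length P))

      start : IsPath G (tail f₀ ∷ head f₀ ∷ [])
      start = (∼-irrefl simple f₀-edge ∷ []) ∷ [] ∷ [] , f₀-edge , tt
        where f₀-edge = All.lookup (alongEdges system) f₀∈

      step : (s : Chase) →
        (∃ λ f → f ∈ D × All (λ e → ¬ MustPrecede G e f) D) ⊎ ∃ λ s′ → size s < size s′
      step (f , f∈ , P , isPath) with any? (λ e → mustPrecede? G e f) D
      ... | no none = inj₁ (f , f∈ , ¬Any⇒All¬ D none)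
      ... | yes some
        with e , e∈ , e≢f , dominated ← find some
        with P′ , isPath′ , longer ← path-back (AllPairs-∈ compatible-sym (compatible system) e∈ f∈ e≢f)
                                               (All.lookup (alongEdges system) e∈) dominated isPath =
        inj₂ ((e , e∈ , P′ , isPath′) , s≤s (s≤s longer))

    undominated-after : ∀ {prev D′} →
      All (λ e → ¬ MustPrecede G e f) D → All (Compatible f) D′ → D′ ⊆ D →
      All (Undominated G prev ∘ head) D → All (Undominated G (tail f ∷ prev) ∘ head) D′
    undominated-after minimal f-compatible D′⊆ undominated = All.tabulate λ e∈ →
      let may-follow = All.lookup minimal (D′⊆ e∈)
          e≢f = λ e≡f → compatible⇒≢ (All.lookup f-compatible e∈) (sym e≡f)
      in ((λ adjacent → may-follow (e≢f , inj₁ adjacent)) , (λ equal → may-follow (e≢f , inj₂ equal)))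
         ∷ All.lookup undominated (D′⊆ e∈)

    arcSystem⇒zSeqFrom : ∀ {prev} D k → length D ≡ k → ArcSystem G D → All (Undominated G prev ∘ head) D →
      ∃ λ s → ZSeqFrom G prev s × length s ≡ k
    arcSystem⇒zSeqFrom [] zero refl _ _ = [] , tt , refl
    arcSystem⇒zSeqFrom (_ ∷ _) (suc k) len system undominated
      with f , f∈ , minimal ← minimal-arc system (here refl)
      with D′ , len′ , compatible′ , f-compatible , D′⊆
             ← AllPairs-remove compatible-sym (compatible system) f∈
      with s , zs , ls ← arcSystem⇒zSeqFrom D′ k (suc-injective (trans (sym len′) len))
                           (arcSystem compatible′ (anti-mono D′⊆ (alongEdges system)))
                           (undominated-after minimal f-compatible D′⊆ undominated) =
      tail f ∷ s , ((head f , All.lookup (alongEdges system) f∈ , All.lookup undominated f∈) , zs) , cong suc ls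

    arcSystem⇒zSeq : ArcSystem G D → ∃ λ s → IsZSeq G s × length s ≡ length D
    arcSystem⇒zSeq {D = D} system = arcSystem⇒zSeqFrom D _ refl system (All.universal (λ _ → []) D)

  open DecMembership (_≟_ {n}) using (_∈?_)

  reorient : List (Fin n) → Arc → Arc
  reorient L e = if does (head e ∈? L) then swap e else e

  reorient-cases : ∀ L e → (head e ∈ L × reorient L e ≡ swap e) ⊎ (head e ∉ L × reorient L e ≡ e)
  reorient-cases L e with head e ∈? L
  ... | yes h∈ = inj₁ (h∈ , refl)
  ... | no h∉  = inj₂ (h∉ , refl)

  Saturated : List (Fin n) → Arc → Set
  Saturated L e = tail e ∈ L ⇔ head e ∈ L

  compatible-swap : Compatible e f → Compatible (swap e) (swap f)
  compatible-swap (tails≢ , heads≢ , ≢swap) = heads≢ , tails≢ , ≢swap ∘ cong swap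

  compatible-across : tail e ∈ L → head e ∈ L → tail f ∉ L → head f ∉ L → Compatible (swap e) f
  compatible-across {L = L} te∈ he∈ tf∉ hf∉ =
    (λ he≡tf → tf∉ (subst (_∈ L) he≡tf he∈)) ,
    (λ te≡hf → hf∉ (subst (_∈ L) te≡hf te∈)) ,
    (λ swaps≡ → hf∉ (subst (_∈ L) (cong proj₁ swaps≡) he∈))

  reorient-compatible : Saturated L e → Saturated L f → Compatible e f → Compatible (reorient L e) (reorient L f)
  reorient-compatible {L = L} {e = e} {f = f} e-sat f-sat ef
    with reorient-cases L e | reorient-cases L f
  ... | inj₁ (he∈ , e↦) | inj₁ (hf∈ , f↦) = subst₂ Compatible (sym e↦) (sym f↦) (compatible-swap ef)
  ... | inj₂ (he∉ , e↦) | inj₂ (hf∉ , f↦) = subst₂ Compatible (sym e↦) (sym f↦) ef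
  ... | inj₁ (he∈ , e↦) | inj₂ (hf∉ , f↦) =
    subst₂ Compatible (sym e↦) (sym f↦) (compatible-across (from e-sat he∈) he∈ (hf∉ ∘ to f-sat) hf∉)
  ... | inj₂ (he∉ , e↦) | inj₁ (hf∈ , f↦) =
    subst₂ Compatible (sym e↦) (sym f↦)
      (compatible-sym (compatible-across (from f-sat hf∈) hf∈ (he∉ ∘ to e-sat) he∉))

  reorient-edge : IsSimple G → tail e ∼[ G ] head e → tail (reorient L e) ∼[ G ] head (reorient L e)
  reorient-edge {G = G} {e = e} {L = L} simple e-edge with reorient-cases L e
  ... | inj₁ (_ , e↦) = subst (λ e′ → tail e′ ∼[ G ] head e′) (sym e↦) (∼-sym simple e-edge)
  ... | inj₂ (_ , e↦) = subst (λ e′ → tail e′ ∼[ G ] head e′) (sym e↦) e-edge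

  module _ (simple : IsSimple G) (system : ArcSystem G D) (p∼q : p ∼[ G ] q)
           (p-not-tail : All (λ e → tail e ≢ p) D) (q-not-tail : All (λ e → tail e ≢ q) D) where

    -- The directed path of D ending in q, collected backwards from q.
    record Trail : Set where
      field
        first    : Fin n
        rest     : List (Fin n)
        unique   : Unique (first ∷ rest)
        q∈       : q ∈ first ∷ rest
        p∉       : p ∉ first ∷ rest
        forward  : ∀ {e} → e ∈ D → tail e ∈ first ∷ rest → head e ∈ first ∷ rest × head e ≢ first
        backward : ∀ {e} → e ∈ D → head e ∈ first ∷ rest → head e ≢ first → tail e ∈ first ∷ rest

    trail₀ : Trail
    trail₀ = record
      { first    = q
      ; rest     = []
      ; unique   = [] ∷ []
      ; q∈       = here refl
      ; p∉       = λ { (here p≡q) → ∼-irrefl simple p∼q p≡q }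
      ; forward  = λ { e∈ (here t≡q) → contradiction t≡q (All.lookup q-not-tail e∈) }
      ; backward = λ { _ (here h≡q) h≢q → contradiction h≡q h≢q }
      }

    prepend : (trail : Trail) → e ∈ D → head e ≡ Trail.first trail → Trail
    prepend {e = e} trail e∈ arrives = record
      { first    = tail e
      ; rest     = first ∷ rest
      ; unique   = ¬Any⇒All¬ _ fresh ∷ unique
      ; q∈       = there q∈
      ; p∉       = λ { (here p≡t) → All.lookup p-not-tail e∈ (sym p≡t) ; (there p∈) → p∉ p∈ }
      ; forward  = forward′
      ; backward = backward′
      }
      where
      open Trail trail
      fresh : tail e ∉ first ∷ rest
      fresh t∈ = proj₂ (forward e∈ t∈) arrives

      forward′ : ∀ {e′} → e′ ∈ D → tail e′ ∈ tail e ∷ first ∷ rest →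
        head e′ ∈ tail e ∷ first ∷ rest × head e′ ≢ tail e
      forward′ e′∈ (here same) with refl ← same-tail⇒≡ (compatible system) e′∈ e∈ same =
        there (here arrives) , λ h≡t → fresh (here (trans (sym h≡t) arrives))
      forward′ e′∈ (there t∈) =
        there h∈ , λ h≡t → fresh (subst (_∈ first ∷ rest) h≡t h∈)
        where h∈ = proj₁ (forward e′∈ t∈)

      backward′ : ∀ {e′} → e′ ∈ D → head e′ ∈ tail e ∷ first ∷ rest → head e′ ≢ tail e →
        tail e′ ∈ tail e ∷ first ∷ rest
      backward′ e′∈ (here h≡t) h≢t = contradiction h≡t h≢t
      backward′ {e′} e′∈ (there h∈) _ with head e′ ≟ first
      ... | yes h≡first with refl ← same-head⇒≡ (compatible system) e′∈ e∈ (trans h≡first (sym arrives)) =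
        here refl
      ... | no h≢first = there (backward e′∈ h∈ h≢first)

    trail-closes : ∃ λ L → q ∈ L × p ∉ L × All (Saturated L) D
    trail-closes = bounded-ascent size (Unique⇒length≤ ∘ Trail.unique) step trail₀
      where
      size : Trail → ℕ
      size trail = length (Trail.first trail ∷ Trail.rest trail)

      step : (trail : Trail) →
        (∃ λ L → q ∈ L × p ∉ L × All (Saturated L) D) ⊎ ∃ λ trail′ → size trail < size trail′
      step trail with any? (λ e → head e ≟ Trail.first trail) D
      ... | no none = inj₁ (first ∷ rest , q∈ , p∉ , All.tabulate λ e∈ →
              mk⇔ (proj₁ ∘ forward e∈) (λ h∈ → backward e∈ h∈ (All.lookup (¬Any⇒All¬ D none) e∈)))
        where open Trail trail
      ... | yes some with e , e∈ , arrives ← find some = inj₂ (prepend trail e∈ arrives , ≤-refl)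

    new-compatible : q ∈ L → p ∉ L → e ∈ D → Compatible (p , q) (reorient L e)
    new-compatible {L = L} {e = e} q∈ p∉ e∈ with reorient-cases L e
    ... | inj₁ (h∈ , e↦) = subst (Compatible (p , q)) (sym e↦)
      ( (λ p≡h → p∉ (subst (_∈ L) (sym p≡h) h∈))
      , (λ q≡t → All.lookup q-not-tail e∈ (sym q≡t))
      , (λ pq≡e → All.lookup p-not-tail e∈ (sym (cong proj₁ pq≡e))) )
    ... | inj₂ (h∉ , e↦) = subst (Compatible (p , q)) (sym e↦)
      ( (λ p≡t → All.lookup p-not-tail e∈ (sym p≡t))
      , (λ q≡h → h∉ (subst (_∈ L) q≡h q∈))
      , (λ pq≡swap → All.lookup q-not-tail e∈ (sym (cong proj₂ pq≡swap))) )

    augment-by-reversal : ∃ λ D′ → ArcSystem G D′ × length D′ ≡ suc (length D)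
    augment-by-reversal with L , q∈ , p∉ , saturated ← trail-closes =
      (p , q) ∷ map (reorient L) D ,
      arcSystem (map⁺ (All.tabulate (new-compatible q∈ p∉))
                 ∷ AllPairs-map-with reorient-compatible saturated (compatible system))
                (p∼q ∷ map⁺ (All.map (reorient-edge {L = L} simple) (alongEdges system))) ,
      cong suc (length-map (reorient L) D)

  SamePair : (x y u v : Fin n) → Set
  SamePair x y u v = (x ≡ u × y ≡ v) ⊎ (x ≡ v × y ≡ u)

  samePair? : ∀ x y u v → Dec (SamePair x y u v)
  samePair? x y u v = (x ≟ u ×-dec y ≟ v) ⊎-dec (x ≟ v ×-dec y ≟ u)

  OnEdge : Fin n → Fin n → Arc → Set
  OnEdge x y e = SamePair (tail e) (head e) x y

  compatible⇒¬OnEdge : OnEdge x y e → Compatible e f → ¬ OnEdge x y f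
  compatible⇒¬OnEdge (inj₁ (refl , refl)) (tails≢ , _)       (inj₁ (refl , refl)) = tails≢ refl
  compatible⇒¬OnEdge (inj₁ (refl , refl)) (_ , _ , ≢swap) (inj₂ (refl , refl)) = ≢swap refl
  compatible⇒¬OnEdge (inj₂ (refl , refl)) (_ , _ , ≢swap) (inj₁ (refl , refl)) = ≢swap refl
  compatible⇒¬OnEdge (inj₂ (refl , refl)) (tails≢ , _)       (inj₂ (refl , refl)) = tails≢ refl

  Shrinks : Fin n → Fin n → List Arc → List Arc → Set
  Shrinks x y D D′ =
    length D ≡ length D′ ⊎ ∃ λ e → OnEdge x y e × length D ≡ suc (length D′) × All (Compatible e) D′

  record WithoutEdge (x y : Fin n) (D : List Arc) : Set where
    field
      arcs       : List Arc
      arcs⊆      : arcs ⊆ D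
      compatible : AllPairs Compatible arcs
      avoids     : All (¬_ ∘ OnEdge x y) arcs
      shrinks    : Shrinks x y D arcs

  withoutEdge : ∀ x y → AllPairs Compatible D → WithoutEdge x y D
  withoutEdge {D = D} x y compatible with any? (λ e → samePair? (tail e) (head e) x y) D
  ... | no none = record
    { arcs = D ; arcs⊆ = id ; compatible = compatible ; avoids = ¬Any⇒All¬ D none ; shrinks = inj₁ refl }
  ... | yes some
    with e , e∈ , on ← find some
    with D′ , len , compatible′ , e-compatible , D′⊆ ← AllPairs-remove compatible-sym compatible e∈ = record
    { arcs = D′ ; arcs⊆ = D′⊆ ; compatible = compatible′
    ; avoids = All.map (compatible⇒¬OnEdge on) e-compatible ; shrinks = inj₂ (e , on , len , e-compatible) }

  -- Both τ(G) over G and G over τ(G) (with b and c exchanged) are switched in this sense.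
  record Switched (G G′ : Adj n) (a b c d : Fin n) : Set where
    field
      kept : ∀ {x y} → x ∼[ G ] y → ¬ SamePair x y a b → ¬ SamePair x y c d → x ∼[ G′ ] y
      ¬ac  : ¬ a ∼[ G ] c
      ¬bd  : ¬ b ∼[ G ] d
      ac   : a ∼[ G′ ] c
      bd   : b ∼[ G′ ] d

  tails-avoid : All (Compatible (x , y)) D → All (λ e → tail e ≢ x) D
  tails-avoid = All.map λ (tails≢ , _) → tails≢ ∘ sym

  compatible-across-edge : IsSimple G → ¬ x ∼[ G ] y → tail e ∼[ G ] head e →
    Compatible (x , t) e → Compatible (h , y) e → Compatible (x , y) e
  compatible-across-edge simple x≁y e-edge (x≢ , _) (_ , y≢ , _) =
    x≢ , y≢ , λ { refl → x≁y (∼-sym simple e-edge) }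

  augment-across-edge : IsSimple G → ¬ x ∼[ G ] y → x ∼[ G′ ] y → All (λ e → tail e ∼[ G ] head e) D →
    ArcSystem G′ D → All (Compatible (x , t)) D → All (Compatible (h , y)) D → ArcSystem G′ ((x , y) ∷ D)
  augment-across-edge simple x≁y x∼y G-edges system xt hy = arcSystem
    (All.tabulate (λ e∈ → compatible-across-edge simple x≁y (All.lookup G-edges e∈)
                                                 (All.lookup xt e∈) (All.lookup hy e∈))
     ∷ compatible system)
    (x∼y ∷ alongEdges system)

  regain-arc : Switched G G′ a b c d → IsSimple G → IsSimple G′ → All (λ e → tail e ∼[ G ] head e) D →
    ArcSystem G′ D → OnEdge a b e → OnEdge c d f → All (Compatible e) D → All (Compatible f) D →
    ∃ λ D′ → ArcSystem G′ D′ × length D′ ≡ suc (length D)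
  regain-arc switched simple simple′ G-edges system (inj₁ (refl , refl)) (inj₁ (refl , refl)) ab cd =
    augment-by-reversal simple′ system (Switched.ac switched) (tails-avoid ab) (tails-avoid cd)
  regain-arc switched simple simple′ G-edges system (inj₂ (refl , refl)) (inj₂ (refl , refl)) ba dc =
    augment-by-reversal simple′ system (Switched.bd switched) (tails-avoid ba) (tails-avoid dc)
  regain-arc switched simple simple′ G-edges system (inj₁ (refl , refl)) (inj₂ (refl , refl)) ab dc =
    _ , augment-across-edge simple (Switched.¬ac switched) (Switched.ac switched) G-edges system ab dc , refl
  regain-arc switched simple simple′ G-edges system (inj₂ (refl , refl)) (inj₁ (refl , refl)) ba cd =
    _ , augment-across-edge simple (Switched.¬bd switched) (Switched.bd switched) G-edges system ba cd , refl

  arcSystem-switch : Switched G G′ a b c d → IsSimple G → IsSimple G′ → ArcSystem G D →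
    ∃ λ D′ → ArcSystem G′ D′ × length D ≤ suc (length D′)
  arcSystem-switch {G = G} {G′ = G′} {a = a} {b = b} {c = c} {d = d} {D = D}
                   switched simple simple′ (arcSystem compatible₀ edges) = conclude (shrinks R₁) (shrinks R₂)
    where
    open Switched switched
    open WithoutEdge
    R₁ = withoutEdge a b compatible₀
    R₂ = withoutEdge c d (compatible R₁)
    D₂ = arcs R₂

    G-edges : All (λ e → tail e ∼[ G ] head e) D₂
    G-edges = anti-mono (⊆-trans (arcs⊆ R₂) (arcs⊆ R₁)) edges

    system₂ : ArcSystem G′ D₂
    system₂ = arcSystem (compatible R₂) (All.tabulate λ e∈ →
      kept (All.lookup G-edges e∈) (All.lookup (avoids R₁) (arcs⊆ R₂ e∈)) (All.lookup (avoids R₂) e∈))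

    conclude : Shrinks a b D (arcs R₁) → Shrinks c d (arcs R₁) D₂ →
      ∃ λ D′ → ArcSystem G′ D′ × length D ≤ suc (length D′)
    conclude (inj₁ same₁)               (inj₁ same₂)               =
      D₂ , system₂ , ≤-trans (≤-reflexive (trans same₁ same₂)) (n≤1+n _)
    conclude (inj₁ same₁)               (inj₂ (_ , _ , lost₂ , _)) =
      D₂ , system₂ , ≤-reflexive (trans same₁ lost₂)
    conclude (inj₂ (_ , _ , lost₁ , _)) (inj₁ same₂)               =
      D₂ , system₂ , ≤-reflexive (trans lost₁ (cong suc same₂))
    conclude (inj₂ (_ , on₁ , lost₁ , compatible₁)) (inj₂ (_ , on₂ , lost₂ , compatible₂))
      with D′ , system′ , gained ← regain-arc switched simple simple′ G-edges system₂ on₁ on₂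
                                                (anti-mono (arcs⊆ R₂) compatible₁) compatible₂ =
      D′ , system′ , ≤-reflexive (trans lost₁ (cong suc (trans lost₂ (sym gained))))

  zSeq-switch : Switched G G′ a b c d → IsSimple G → IsSimple G′ → IsForest G′ → ∀ {s} → IsZSeq G s →
    ∃ λ s′ → IsZSeq G′ s′ × length s ≤ suc (length s′)
  zSeq-switch switched simple simple′ forest′ {s} zs
    with D , system , _ , D-length ← zSeq⇒arcSystem s zs
    with D′ , system′ , shrink ← arcSystem-switch switched simple simple′ system
    with s′ , zs′ , s′-length ← arcSystem⇒zSeq simple′ forest′ system′ =
    s′ , zs′ , subst₂ (λ i j → i ≤ suc j) D-length (sym s′-length) shrink

  zGrundy-switch : ∀ {k m} → Switched G G′ a b c d → IsSimple G → IsSimple G′ → IsForest G′ →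
    IsZGrundyNumber G k → IsZGrundyNumber G′ m → k ≤ suc m
  zGrundy-switch switched simple simple′ forest′ ((s , zs , refl) , _) (_ , maximal)
    with s′ , zs′ , s≤ ← zSeq-switch switched simple simple′ forest′ zs =
    ≤-trans s≤ (s≤s (maximal s′ zs′))

  samePair-comm : ∀ (x y u v : Fin n) → samePair x y u v ≡ samePair y x u v
  samePair-comm x y u v =
    trans (cong₂ _∨_ (∧-comm (does (x ≟ u)) (does (y ≟ v))) (∧-comm (does (x ≟ v)) (does (y ≟ u))))
          (∨-comm (does (y ≟ v) ∧ does (x ≟ u)) (does (y ≟ u) ∧ does (x ≟ v)))

  samePair-diagonal : SamePair x x a b → a ≡ b
  samePair-diagonal (inj₁ (x≡a , x≡b)) = trans (sym x≡a) x≡b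
  samePair-diagonal (inj₂ (x≡b , x≡a)) = trans (sym x≡a) x≡b

  module TwoSwitch (G : Adj n) (a b c d : Fin n) where

    Removed Added : Fin n → Fin n → Set
    Removed x y = SamePair x y a b ⊎ SamePair x y c d
    Added   x y = SamePair x y a c ⊎ SamePair x y b d

    removed? : ∀ x y → Dec (Removed x y)
    removed? x y = samePair? x y a b ⊎-dec samePair? x y c d

    added? : ∀ x y → Dec (Added x y)
    added? x y = samePair? x y a c ⊎-dec samePair? x y b d

    removed : Removed x y → ¬ x ∼[ twoSwitch G a b c d ] y
    removed {x} {y} r rewrite dec-true (removed? x y) r = id

    added : ¬ Removed x y → Added x y → x ∼[ twoSwitch G a b c d ] y
    added {x} {y} ¬r ad rewrite dec-false (removed? x y) ¬r | dec-true (added? x y) ad = tt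

    unchanged : ¬ Removed x y → ¬ Added x y → twoSwitch G a b c d x y ≡ G x y
    unchanged {x} {y} ¬r ¬ad rewrite dec-false (removed? x y) ¬r | dec-false (added? x y) ¬ad = refl

  twoSwitch-simple : IsSimple G → AllPairs _≢_ (a ∷ b ∷ c ∷ d ∷ []) → IsSimple (twoSwitch G a b c d)
  twoSwitch-simple {G = G} {a = a} {b = b} {c = c} {d = d} (symmetric , loopless)
    ((a≢b ∷ a≢c ∷ _ ∷ []) ∷ (_ ∷ b≢d ∷ []) ∷ (c≢d ∷ []) ∷ [] ∷ []) = symmetric′ , loopless′
    where
    symmetric′ : ∀ x y → twoSwitch G a b c d x y ≡ twoSwitch G a b c d y x
    symmetric′ x y =
      cong₂ (λ removed z → if removed then false else z) (pairs-comm a b c d)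
        (cong₂ (λ added z → if added then true else z) (pairs-comm a c b d) (symmetric x y))
      where
      pairs-comm : ∀ (u v u′ v′ : Fin n) →
        samePair x y u v ∨ samePair x y u′ v′ ≡ samePair y x u v ∨ samePair y x u′ v′
      pairs-comm u v u′ v′ = cong₂ _∨_ (samePair-comm x y u v) (samePair-comm x y u′ v′)
    loopless′ : ∀ x → twoSwitch G a b c d x x ≡ false
    loopless′ x = trans
      (TwoSwitch.unchanged G a b c d [ a≢b ∘ samePair-diagonal , c≢d ∘ samePair-diagonal ]
                                     [ a≢c ∘ samePair-diagonal , b≢d ∘ samePair-diagonal ])
      (loopless x)

  twoSwitch-switched : IsTwoSwitch G a b c d → Switched G (twoSwitch G a b c d) a b c d
  twoSwitch-switched {G = G} {a = a} {b = b} {c = c} {d = d}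
    (((a≢b ∷ a≢c ∷ a≢d ∷ []) ∷ (b≢c ∷ b≢d ∷ []) ∷ _) , _ , _ , ¬ac , ¬bd) = record
    { kept = kept
    ; ¬ac  = ¬ac
    ; ¬bd  = ¬bd
    ; ac   = added ac-not-removed (inj₁ (inj₁ (refl , refl)))
    ; bd   = added bd-not-removed (inj₂ (inj₁ (refl , refl)))
    }
    where
    open TwoSwitch G a b c d
    kept : x ∼[ G ] y → ¬ SamePair x y a b → ¬ SamePair x y c d → x ∼[ twoSwitch G a b c d ] y
    kept {x} {y} x∼y ¬ab ¬cd with added? x y
    ... | yes ad  = added [ ¬ab , ¬cd ] ad
    ... | no ¬ad = subst T (sym (unchanged [ ¬ab , ¬cd ] ¬ad)) x∼y
    ac-not-removed : ¬ Removed a c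
    ac-not-removed (inj₁ (inj₁ (_ , c≡b)))   = b≢c (sym c≡b)
    ac-not-removed (inj₁ (inj₂ (a≡b , _)))   = a≢b a≡b
    ac-not-removed (inj₂ (inj₁ (a≡c , _)))   = a≢c a≡c
    ac-not-removed (inj₂ (inj₂ (a≡d , _)))   = a≢d a≡d
    bd-not-removed : ¬ Removed b d
    bd-not-removed (inj₁ (inj₁ (b≡a , _)))   = a≢b (sym b≡a)
    bd-not-removed (inj₁ (inj₂ (_ , d≡a)))   = a≢d (sym d≡a)
    bd-not-removed (inj₂ (inj₁ (b≡c , _)))   = b≢c b≡c
    bd-not-removed (inj₂ (inj₂ (b≡d , _)))   = b≢d b≡d

  twoSwitch-switched⁻¹ : IsTwoSwitch G a b c d → Switched (twoSwitch G a b c d) G a c b d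
  twoSwitch-switched⁻¹ {G = G} {a = a} {b = b} {c = c} {d = d} (_ , ab , cd , _) = record
    { kept = kept
    ; ¬ac  = removed (inj₁ (inj₁ (refl , refl)))
    ; ¬bd  = removed (inj₂ (inj₁ (refl , refl)))
    ; ac   = ab
    ; bd   = cd
    }
    where
    open TwoSwitch G a b c d
    kept : x ∼[ twoSwitch G a b c d ] y → ¬ SamePair x y a c → ¬ SamePair x y b d → x ∼[ G ] y
    kept {x} {y} x∼y ¬ac ¬bd with removed? x y
    ... | yes r  = contradiction x∼y (removed r)
    ... | no ¬r = subst T (unchanged ¬r [ ¬ac , ¬bd ]) x∼y

mainTheorem17 : ∀ (n : ℕ) (F : Adj n) → IsSimple F → IsForest F → NoIsolated F →
    ∀ (a b c d : Fin n) → IsTwoSwitch F a b c d → IsForest (twoSwitch F a b c d) →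
    ∀ (k m : ℕ) → IsZGrundyNumber F k → IsZGrundyNumber (twoSwitch F a b c d) m →
    ∣ m - k ∣ ≤ 1
mainTheorem17 n F simple forest _ a b c d switch forest′ k m zGrundy zGrundy′ =
  ∣m-n∣≤1 (zGrundy-switch (twoSwitch-switched switch) simple simple′ forest′ zGrundy zGrundy′)
          (zGrundy-switch (twoSwitch-switched⁻¹ switch) simple′ simple forest zGrundy′ zGrundy)
  where
  simple′ : IsSimple (twoSwitch F a b c d)
  simple′ = twoSwitch-simple simple (proj₁ switch)
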